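{- Let $d\geq 3$, let $W_d=\langle x_1,\ldots,x_d\mid x_1^2,\ldots,x_d^2\rangle$, let $y_i=x_ix_d$ for $i\in\{1,\ldots,d-1\}$, and let $F_{d-1}=\langle y_1,\ldots,y_{d-1}\rangle\leq W_d$ (a free group of rank $d-1$). Define $P_1=F_{d-1}$ and $P_i=[P_{i-1},F_{d-1}]P_{i-1}^2$ for $i\geq 2$. Then $P_i=\gamma_i(W_d)$ for every $i\geq 2$.
   Context: For a group $G$, $G^2=\langle g^2\mid g\in G\rangle$; for subgroups $H,K$, $[H,K]=\langle[h,k]\mid h\in H,k\in K\rangle$ with $[h,k]=h^{ -1}k^{ -1}hk$. $\gamma_i(G)$ is the $i$th term of the lower central series: $\gamma_1(G)=G$, $\gamma_{i+1}(G)=[\gamma_i(G),G]$. -}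

module Defs where

open import Data.Nat using (ℕ; zero; suc; _∸_; _<_)
open import Data.Fin using (Fin; toℕ; _≟_)
open import Data.List using (List; []; _∷_; _++_; foldr; reverse)
open import Data.Product using (Σ; _×_; ∃-syntax)
open import Data.Unit using (⊤)
open import Relation.Nullary using (yes; no)
open import Relation.Binary.PropositionalEquality using (_≡_)

-- The right-angled Coxeter group W_d = ⟨x_1,…,x_d | x_1²,…,x_d²⟩ = free product
-- of d copies of C₂.  An element is represented by a word (list of generator
-- indices; the letter i stands for x_{i+1}).  Two words are equal in W_d iff
-- they have the same normal form, obtained by cancelling adjacent equal letters.

Word : ℕ → Set
Word d = List (Fin d)

cons : ∀ {d} → Fin d → Word d → Word d
cons x [] = x ∷ []
cons x (y ∷ w) with x ≟ y
... | yes _ = w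
... | no  _ = x ∷ y ∷ w

reduce : ∀ {d} → Word d → Word d
reduce = foldr cons []

_≈_ : ∀ {d} → Word d → Word d → Set
u ≈ v = reduce u ≡ reduce v

_·_ : ∀ {d} → Word d → Word d → Word d
u · v = u ++ v

-- every generator is an involution, so the inverse is the reversed word
inv : ∀ {d} → Word d → Word d
inv = reverse

comm : ∀ {d} → Word d → Word d → Word d
comm h k = inv h · (inv k · (h · k))

-- subsets of W_d (predicates respecting nothing in particular; the
-- subgroups below are closed under ≈ by construction)
Subset : ℕ → Set₁
Subset d = Word d → Set

data ⟨_⟩ {d} (S : Subset d) : Subset d where
  gen  : ∀ {g} → S g → ⟨ S ⟩ g
  one  : ⟨ S ⟩ []
  mul  : ∀ {g h} → ⟨ S ⟩ g → ⟨ S ⟩ h → ⟨ S ⟩ (g · h)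
  inv∈ : ∀ {g} → ⟨ S ⟩ g → ⟨ S ⟩ (inv g)
  resp : ∀ {g h} → g ≈ h → ⟨ S ⟩ g → ⟨ S ⟩ h

Whole : ∀ d → Subset d
Whole d _ = ⊤

[_,_] : ∀ {d} → Subset d → Subset d → Subset d
[ H , K ] = ⟨ (λ g → ∃[ h ] ∃[ k ] (H h × K k × g ≡ comm h k)) ⟩

Sq : ∀ {d} → Subset d → Subset d
Sq H = ⟨ (λ g → ∃[ h ] (H h × g ≡ h · h)) ⟩

_⊙_ : ∀ {d} → Subset d → Subset d → Subset d
(H ⊙ K) g = ∃[ h ] ∃[ k ] (H h × K k × g ≈ (h · k))

Fgens : ∀ d → Subset d
Fgens d g = ∃[ i ] ∃[ j ] (toℕ i < d ∸ 1 × toℕ j ≡ d ∸ 1 × g ≡ i ∷ j ∷ [])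

F : ∀ d → Subset d
F d = ⟨ Fgens d ⟩

-- P d i  represents P_i for i ≥ 1 (P d 0 is an unused dummy, set to F)
P : ∀ d → ℕ → Subset d
P d zero = F d
P d (suc zero) = F d
P d (suc (suc n)) = [ P d (suc n) , F d ] ⊙ Sq (P d (suc n))

-- lower central series γ_i(W_d) for i ≥ 1 (γ 0 is an unused dummy)
γ : ∀ d → ℕ → Subset d
γ d zero = Whole d
γ d (suc zero) = Whole d
γ d (suc (suc n)) = [ γ d (suc n) , Whole d ]

-- F_{d-1} is the index-2 subgroup of even-length words, generated by the
-- x_i t with t = x_d.  As every letter is an involution, [x,z] = (xz)² and all
-- squares lie in γ₂, which gives γ₂ = [F,F]F².  For the inductive step put
-- Q = γ_i = [γ_{i-1},W]; it suffices that [Q,W] = [Q,F]Q².  Squares of Q lie in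
-- [Q,W] since [c,x]² = [[c,x],x]⁻¹.  Conversely [q,x] ≡ [q,t] modulo [Q,F], and
-- as conjugation by x inverts q = [c,x], one gets [q,t] = q⁻² [q⁻¹,xt] ∈ Q²[Q,F].

module Submission where

open import Data.Bool using (Bool; true; false; not; _xor_) renaming (_≟_ to _≟ᵇ_)
open import Data.Bool.Properties using (not-involutive; xor-same; xor-comm; xor-inverseʳ; not-distribˡ-xor)
open import Data.Empty using (⊥-elim)
open import Data.Fin using (Fin; zero; suc; toℕ; fromℕ; _≟_)
open import Data.Fin.Properties using (toℕ-injective; toℕ-fromℕ; toℕ≤pred[n])
open import Data.List using (List; []; _∷_; _++_; foldr; reverse)
open import Data.List.Properties
  using (foldr-++; reverse-++; reverse-involutive; ++-assoc; ++-identityʳ)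
open import Data.Maybe using (Maybe; just; nothing)
open import Data.Nat using (ℕ; zero; suc; _+_; _≤_; s≤s) renaming (_≟_ to _≟ℕ_)
open import Data.Nat.Properties using (≤∧≢⇒<)
open import Data.Product using (_×_; _,_; proj₁; proj₂)
open import Data.Unit using (tt)
open import Data.Vec using (Vec; []; _∷_; lookup)
open import Relation.Binary.PropositionalEquality
  using (_≡_; _≢_; refl; sym; trans; cong; cong₂; module ≡-Reasoning)
open import Relation.Binary.Bundles using (Setoid)
import Relation.Binary.Reasoning.Setoid as SetoidReasoning
open import Relation.Nullary using (yes; no)
open import Relation.Unary using (_⊆_; _≐_; _∩_)

open import Defs

module _ {d : ℕ} where

  data Reduced : Word d → Set where
    empty  : Reduced []
    single : ∀ x → Reduced (x ∷ [])
    link   : ∀ {x y w} → x ≢ y → Reduced (y ∷ w) → Reduced (x ∷ y ∷ w)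

  reduced-tail : ∀ {x w} → Reduced (x ∷ w) → Reduced w
  reduced-tail (single _) = empty
  reduced-tail (link _ r) = r

  cons-reduced : ∀ x {w} → Reduced w → Reduced (cons x w)
  cons-reduced x empty = single x
  cons-reduced x {y ∷ w} r with x ≟ y
  ... | yes _ = reduced-tail r
  ... | no x≢y = link x≢y r

  cons-involutive : ∀ x {w} → Reduced w → cons x (cons x w) ≡ w
  cons-involutive x empty with x ≟ x
  ... | yes _ = refl
  ... | no x≢x = ⊥-elim (x≢x refl)
  cons-involutive x {y ∷ w} r with x ≟ y
  cons-involutive x {y ∷ []} r | yes refl = refl
  cons-involutive x {y ∷ z ∷ w} (link y≢z _) | yes refl with x ≟ z
  ... | yes x≡z = ⊥-elim (y≢z x≡z)
  ... | no _ = refl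
  cons-involutive x {y ∷ w} r | no _ with x ≟ x
  ... | yes _ = refl
  ... | no x≢x = ⊥-elim (x≢x refl)

  -- prepend u r is the reduced form of u ++ r when r is reduced.
  prepend : Word d → Word d → Word d
  prepend u r = foldr cons r u

  prepend-reduced : ∀ u {r} → Reduced r → Reduced (prepend u r)
  prepend-reduced [] r = r
  prepend-reduced (x ∷ u) r = cons-reduced x (prepend-reduced u r)

  reduce-reduced : ∀ u → Reduced (reduce u)
  reduce-reduced u = prepend-reduced u empty

  prepend-cons : ∀ x {s r} → Reduced s → Reduced r →
                 prepend (cons x s) r ≡ cons x (prepend s r)
  prepend-cons x empty _ = refl
  prepend-cons x {y ∷ s} _ r with x ≟ y
  ... | yes refl = sym (cons-involutive x (prepend-reduced s r))
  ... | no _ = refl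

  prepend-reduce : ∀ u {r} → Reduced r → prepend u r ≡ prepend (reduce u) r
  prepend-reduce [] _ = refl
  prepend-reduce (x ∷ u) r = trans (cong (cons x) (prepend-reduce u r))
                                   (sym (prepend-cons x (reduce-reduced u) r))

  reduce-++ : ∀ u v → reduce (u ++ v) ≡ prepend (reduce u) (reduce v)
  reduce-++ u v = trans (foldr-++ cons [] u v) (prepend-reduce u (reduce-reduced v))

-- _≈_ unfolds to an equation between normal forms, from which Agda cannot
-- recover the two words; the wrapper makes them inferable.
infix 4 _≋_
data _≋_ {d} (u v : Word d) : Set where
  from≈ : u ≈ v → u ≋ v

module _ {d : ℕ} where

  to≈ : {u v : Word d} → u ≋ v → u ≈ v
  to≈ (from≈ p) = p

  ≈⇒≋ : (u v : Word d) → u ≈ v → u ≋ v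
  ≈⇒≋ _ _ = from≈

  ≋-refl : {u : Word d} → u ≋ u
  ≋-refl = from≈ refl

  ≋-sym : {u v : Word d} → u ≋ v → v ≋ u
  ≋-sym (from≈ p) = from≈ (sym p)

  ≋-trans : {u v w : Word d} → u ≋ v → v ≋ w → u ≋ w
  ≋-trans (from≈ p) (from≈ q) = from≈ (trans p q)

  ≋-reflexive : {u v : Word d} → u ≡ v → u ≋ v
  ≋-reflexive refl = ≋-refl

  ≋-setoid : Setoid _ _
  ≋-setoid = record
    { Carrier = Word d
    ; _≈_ = _≋_
    ; isEquivalence = record { refl = ≋-refl ; sym = ≋-sym ; trans = ≋-trans } }

  ·-congˡ : ∀ w {u v : Word d} → u ≋ v → (w · u) ≋ (w · v)
  ·-congˡ w {u} {v} (from≈ u≈v) = from≈ (begin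
    reduce (w ++ u)        ≡⟨ foldr-++ cons [] w u ⟩
    prepend w (reduce u)   ≡⟨ cong (prepend w) u≈v ⟩
    prepend w (reduce v)   ≡⟨ foldr-++ cons [] w v ⟨
    reduce (w ++ v)        ∎)
    where open ≡-Reasoning

  ·-congʳ : ∀ w {u v : Word d} → u ≋ v → (u · w) ≋ (v · w)
  ·-congʳ w {u} {v} (from≈ u≈v) = from≈ (begin
    reduce (u ++ w)                   ≡⟨ reduce-++ u w ⟩
    prepend (reduce u) (reduce w)     ≡⟨ cong (λ r → prepend r (reduce w)) u≈v ⟩
    prepend (reduce v) (reduce w)     ≡⟨ reduce-++ v w ⟨
    reduce (v ++ w)                   ∎)
    where open ≡-Reasoning

  ·-cong : {u u′ v v′ : Word d} → u ≋ u′ → v ≋ v′ → (u · v) ≋ (u′ · v′)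
  ·-cong {u′ = u′} {v} p q = ≋-trans (·-congʳ v p) (·-congˡ u′ q)

  ·-inverseʳ : ∀ (u : Word d) → (u · inv u) ≋ []
  ·-inverseʳ [] = ≋-refl
  ·-inverseʳ (x ∷ u) = from≈ (trans (cong (cons x) inner) (cons-involutive x empty))
    where
    open ≡-Reasoning
    inner : reduce (u ++ reverse (x ∷ u)) ≡ x ∷ []
    inner = begin
      reduce (u ++ reverse (x ∷ u))               ≡⟨ cong (λ v → reduce (u ++ v)) (reverse-++ (x ∷ []) u) ⟩
      reduce (u ++ (reverse u ++ x ∷ []))         ≡⟨ cong reduce (++-assoc u (reverse u) (x ∷ [])) ⟨
      reduce ((u ++ reverse u) ++ x ∷ [])         ≡⟨ reduce-++ (u ++ reverse u) (x ∷ []) ⟩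
      prepend (reduce (u ++ reverse u)) (x ∷ [])  ≡⟨ cong (λ r → prepend r (x ∷ [])) (to≈ (·-inverseʳ u)) ⟩
      x ∷ []                                      ∎

  ·-inverseˡ : ∀ (u : Word d) → (inv u · u) ≋ []
  ·-inverseˡ u = ≋-trans (·-congˡ (inv u) (≋-reflexive (sym (reverse-involutive u))))
                         (·-inverseʳ (reverse u))

  letter-square : ∀ (x : Fin d) → ((x ∷ []) · (x ∷ [])) ≋ []
  letter-square x = from≈ (cons-involutive x empty)

  inv-cong : {u v : Word d} → u ≋ v → inv u ≋ inv v
  inv-cong {u} {v} u≋v = begin
    inv u                  ≡⟨ ++-identityʳ (inv u) ⟨
    inv u · []             ≈⟨ ·-congˡ (inv u) (·-inverseʳ v) ⟨
    inv u · (v · inv v)    ≈⟨ ·-congˡ (inv u) (·-congʳ (inv v) u≋v) ⟨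
    inv u · (u · inv v)    ≡⟨ ++-assoc (inv u) u (inv v) ⟨
    (inv u · u) · inv v    ≈⟨ ·-congʳ (inv v) (·-inverseˡ u) ⟩
    inv v                  ∎
    where open SetoidReasoning ≋-setoid

conj : ∀ {d} → Word d → Word d → Word d
conj g w = inv w · (g · w)

-- Identities in W_d are decided by normalising formal expressions over
-- arbitrary words (free-group cancellation) and letters (which are involutions).
module WordSolver where

  data Expr (n m : ℕ) : Set where
    var    : Fin n → Expr n m
    letter : Fin m → Expr n m
    ε      : Expr n m
    _⊗_    : Expr n m → Expr n m → Expr n m
    ı      : Expr n m → Expr n m

  commᴱ conjᴱ : ∀ {n m} → Expr n m → Expr n m → Expr n m
  commᴱ a b = ı a ⊗ (ı b ⊗ (a ⊗ b))
  conjᴱ g w = ı w ⊗ (g ⊗ w)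

  data Atom (n m : ℕ) : Set where
    var    : Fin n → Bool → Atom n m
    letter : Fin m → Atom n m

  data Cancels {n m} : Atom n m → Atom n m → Set where
    var    : ∀ i b → Cancels (var i b) (var i (not b))
    letter : ∀ j → Cancels (letter j) (letter j)

  cancels? : ∀ {n m} (a b : Atom n m) → Maybe (Cancels a b)
  cancels? (var i b) (var i′ b′) with i ≟ i′ | b′ ≟ᵇ not b
  ... | yes refl | yes refl = just (var i b)
  ... | _        | _        = nothing
  cancels? (letter j) (letter j′) with j ≟ j′
  ... | yes refl = just (letter j)
  ... | no _     = nothing
  cancels? _ _ = nothing

  consᴬ : ∀ {n m} → Atom n m → List (Atom n m) → List (Atom n m)
  consᴬ a [] = a ∷ []
  consᴬ a (b ∷ l) with cancels? a b
  ... | just _  = l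
  ... | nothing = a ∷ b ∷ l

  -- The Boolean records whether the expression is read upright or inverted.
  flatten : ∀ {n m} → Bool → Expr n m → List (Atom n m)
  flatten b     (var i)    = var i b ∷ []
  flatten b     (letter j) = letter j ∷ []
  flatten b     ε          = []
  flatten true  (e ⊗ f)    = flatten true e ++ flatten true f
  flatten false (e ⊗ f)    = flatten false f ++ flatten false e
  flatten b     (ı e)      = flatten (not b) e

  normalise : ∀ {n m} → Expr n m → List (Atom n m)
  normalise e = foldr consᴬ [] (flatten true e)

  module _ {d n m : ℕ} (ρ : Vec (Word d) n) (σ : Vec (Fin d) m) where

    eval : Expr n m → Word d
    eval (var i)    = lookup ρ i
    eval (letter j) = lookup σ j ∷ []
    eval ε          = []
    eval (e ⊗ f)    = eval e · eval f
    eval (ı e)      = inv (eval e)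

    evalᴬ : Atom n m → Word d
    evalᴬ (var i true)  = lookup ρ i
    evalᴬ (var i false) = inv (lookup ρ i)
    evalᴬ (letter j)    = lookup σ j ∷ []

    evalᴸ : List (Atom n m) → Word d
    evalᴸ = foldr (λ a w → evalᴬ a ++ w) []

    evalᴸ-++ : ∀ as bs → evalᴸ (as ++ bs) ≡ evalᴸ as ++ evalᴸ bs
    evalᴸ-++ []       bs = refl
    evalᴸ-++ (a ∷ as) bs = trans (cong (evalᴬ a ++_) (evalᴸ-++ as bs))
                                 (sym (++-assoc (evalᴬ a) (evalᴸ as) (evalᴸ bs)))

    flatten-upright  : ∀ e → evalᴸ (flatten true e) ≡ eval e
    flatten-inverted : ∀ e → evalᴸ (flatten false e) ≡ inv (eval e)
    flatten-upright (var i)    = ++-identityʳ (lookup ρ i)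
    flatten-upright (letter j) = refl
    flatten-upright ε          = refl
    flatten-upright (e ⊗ f)    = trans (evalᴸ-++ (flatten true e) (flatten true f))
                                       (cong₂ _++_ (flatten-upright e) (flatten-upright f))
    flatten-upright (ı e)      = flatten-inverted e
    flatten-inverted (var i)    = ++-identityʳ (inv (lookup ρ i))
    flatten-inverted (letter j) = refl
    flatten-inverted ε          = refl
    flatten-inverted (e ⊗ f)    = trans (evalᴸ-++ (flatten false f) (flatten false e))
      (trans (cong₂ _++_ (flatten-inverted f) (flatten-inverted e))
             (sym (reverse-++ (eval e) (eval f))))
    flatten-inverted (ı e)      = trans (flatten-upright e) (sym (reverse-involutive (eval e)))

    cancels-sound : ∀ {a b} → Cancels a b → (evalᴬ a · evalᴬ b) ≋ []
    cancels-sound (var i true)  = ·-inverseʳ (lookup ρ i)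
    cancels-sound (var i false) = ·-inverseˡ (lookup ρ i)
    cancels-sound (letter j)    = letter-square (lookup σ j)

    consᴬ-sound : ∀ a as → evalᴸ (consᴬ a as) ≋ (evalᴬ a · evalᴸ as)
    consᴬ-sound a [] = ≋-refl
    consᴬ-sound a (b ∷ as) with cancels? a b
    ... | nothing = ≋-refl
    ... | just c  = ≋-sym (≋-trans (≋-reflexive (sym (++-assoc (evalᴬ a) (evalᴬ b) (evalᴸ as))))
                                   (·-congʳ (evalᴸ as) (cancels-sound c)))

    foldr-consᴬ-sound : ∀ as → evalᴸ (foldr consᴬ [] as) ≋ evalᴸ as
    foldr-consᴬ-sound []       = ≋-refl
    foldr-consᴬ-sound (a ∷ as) = ≋-trans (consᴬ-sound a (foldr consᴬ [] as))
                                         (·-congˡ (evalᴬ a) (foldr-consᴬ-sound as))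

    normalise-sound : ∀ e → evalᴸ (normalise e) ≋ eval e
    normalise-sound e = ≋-trans (foldr-consᴬ-sound (flatten true e))
                                (≋-reflexive (flatten-upright e))

    prove : ∀ e f → normalise e ≡ normalise f → eval e ≋ eval f
    prove e f e≡f = ≋-trans (≋-sym (normalise-sound e))
                            (≋-trans (≋-reflexive (cong evalᴸ e≡f)) (normalise-sound f))

open WordSolver using (Expr; var; letter; ε; _⊗_; ı; commᴱ; conjᴱ; prove)

x₀ : ∀ {n m} → Expr (suc n) m
x₀ = var zero
x₁ : ∀ {n m} → Expr (suc (suc n)) m
x₁ = var (suc zero)
x₂ : ∀ {n m} → Expr (suc (suc (suc n))) m
x₂ = var (suc (suc zero))
x₃ : ∀ {n m} → Expr (suc (suc (suc (suc n)))) m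
x₃ = var (suc (suc (suc zero)))
ℓ₀ : ∀ {n m} → Expr n (suc m)
ℓ₀ = letter zero
ℓ₁ : ∀ {n m} → Expr n (suc (suc m))
ℓ₁ = letter (suc zero)
ℓ₂ : ∀ {n m} → Expr n (suc (suc (suc m)))
ℓ₂ = letter (suc (suc zero))

module _ {d : ℕ} where

  comm-identityʳ : ∀ (c : Word d) → comm c [] ≋ []
  comm-identityʳ c = prove (c ∷ []) [] (commᴱ x₀ ε) ε refl

  comm-identityˡ : ∀ (k : Word d) → comm [] k ≋ []
  comm-identityˡ k = prove (k ∷ []) [] (commᴱ ε x₀) ε refl

  comm-swap : ∀ (a b : Word d) → comm a b ≋ inv (comm b a)
  comm-swap a b = prove (a ∷ b ∷ []) [] (commᴱ x₀ x₁) (ı (commᴱ x₁ x₀)) refl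

  comm-·ʳ : ∀ (c a b : Word d) → comm c (a · b) ≋ (comm c b · conj (comm c a) b)
  comm-·ʳ c a b = prove (c ∷ a ∷ b ∷ []) []
    (commᴱ x₀ (x₁ ⊗ x₂)) (commᴱ x₀ x₂ ⊗ conjᴱ (commᴱ x₀ x₁) x₂) refl

  comm-·ˡ : ∀ (a b k : Word d) → comm (a · b) k ≋ (conj (comm a k) b · comm b k)
  comm-·ˡ a b k = prove (a ∷ b ∷ k ∷ []) []
    (commᴱ (x₀ ⊗ x₁) x₂) (conjᴱ (commᴱ x₀ x₂) x₁ ⊗ commᴱ x₁ x₂) refl

  comm-invˡ : ∀ (a k : Word d) → comm (inv a) k ≋ conj (inv (comm a k)) (inv a)
  comm-invˡ a k = prove (a ∷ k ∷ []) [] (commᴱ (ı x₀) x₁) (conjᴱ (ı (commᴱ x₀ x₁)) (ı x₀)) refl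

  comm-conjˡ : ∀ (g w k : Word d) →
               comm (conj g w) k ≋ (conj (comm g k) w · comm (conj (conj g k) w) (comm w k))
  comm-conjˡ g w k = prove (g ∷ w ∷ k ∷ []) []
    (commᴱ (conjᴱ x₀ x₁) x₂)
    (conjᴱ (commᴱ x₀ x₂) x₁ ⊗ commᴱ (conjᴱ (conjᴱ x₀ x₂) x₁) (commᴱ x₁ x₂)) refl

  conj-identityˡ : ∀ (w : Word d) → conj [] w ≋ []
  conj-identityˡ w = prove (w ∷ []) [] (conjᴱ ε x₀) ε refl

  conj-· : ∀ (g h w : Word d) → conj (g · h) w ≋ (conj g w · conj h w)
  conj-· g h w = prove (g ∷ h ∷ w ∷ []) [] (conjᴱ (x₀ ⊗ x₁) x₂) (conjᴱ x₀ x₂ ⊗ conjᴱ x₁ x₂) refl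

  conj-inv : ∀ (g w : Word d) → conj (inv g) w ≋ inv (conj g w)
  conj-inv g w = prove (g ∷ w ∷ []) [] (conjᴱ (ı x₀) x₁) (ı (conjᴱ x₀ x₁)) refl

  conj-comm : ∀ (h k w : Word d) → conj (comm h k) w ≋ comm (conj h w) (conj k w)
  conj-comm h k w = prove (h ∷ k ∷ w ∷ []) []
    (conjᴱ (commᴱ x₀ x₁) x₂) (commᴱ (conjᴱ x₀ x₂) (conjᴱ x₁ x₂)) refl

  ·-interchange : ∀ (h₁ k₁ h₂ k₂ : Word d) →
                  ((h₁ · k₁) · (h₂ · k₂)) ≋ ((h₁ · conj h₂ (inv k₁)) · (k₁ · k₂))
  ·-interchange h₁ k₁ h₂ k₂ = prove (h₁ ∷ k₁ ∷ h₂ ∷ k₂ ∷ []) []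
    ((x₀ ⊗ x₁) ⊗ (x₂ ⊗ x₃)) ((x₀ ⊗ conjᴱ x₂ (ı x₁)) ⊗ (x₁ ⊗ x₃)) refl

  inv-· : ∀ (h k : Word d) → inv (h · k) ≋ (conj (inv h) k · inv k)
  inv-· h k = prove (h ∷ k ∷ []) [] (ı (x₀ ⊗ x₁)) (conjᴱ (ı x₀) x₁ ⊗ ı x₁) refl

  square-· : ∀ (a b : Word d) → ((a · b) · (a · b)) ≋ (((a · a) · comm a (inv b)) · (b · b))
  square-· a b = prove (a ∷ b ∷ []) []
    ((x₀ ⊗ x₁) ⊗ (x₀ ⊗ x₁)) (((x₀ ⊗ x₀) ⊗ commᴱ x₀ (ı x₁)) ⊗ (x₁ ⊗ x₁)) refl

  square-inv : ∀ (a : Word d) → (inv a · inv a) ≋ inv (a · a)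
  square-inv a = prove (a ∷ []) [] (ı x₀ ⊗ ı x₀) (ı (x₀ ⊗ x₀)) refl

  square-∷ : ∀ (x : Fin d) (h : Word d) → ((x ∷ h) · (x ∷ h)) ≋ (comm (x ∷ []) (inv h) · (h · h))
  square-∷ x h = prove (h ∷ []) (x ∷ [])
    ((ℓ₀ ⊗ x₀) ⊗ (ℓ₀ ⊗ x₀)) (commᴱ ℓ₀ (ı x₀) ⊗ (x₀ ⊗ x₀)) refl

  -- Conjugation by the letter x inverts [c,x].
  square-comm-letter : ∀ (c : Word d) (x : Fin d) →
    (comm c (x ∷ []) · comm c (x ∷ [])) ≋ inv (comm (comm c (x ∷ [])) (x ∷ []))
  square-comm-letter c x = prove (c ∷ []) (x ∷ [])
    (commᴱ x₀ ℓ₀ ⊗ commᴱ x₀ ℓ₀) (ı (commᴱ (commᴱ x₀ ℓ₀) ℓ₀)) refl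

  comm-letter-split : ∀ (q : Word d) (x t : Fin d) →
    comm q (x ∷ []) ≋ (comm q (t ∷ []) · conj (comm q (x ∷ t ∷ [])) (t ∷ []))
  comm-letter-split q x t = prove (q ∷ []) (x ∷ t ∷ [])
    (commᴱ x₀ ℓ₀) (commᴱ x₀ ℓ₁ ⊗ conjᴱ (commᴱ x₀ (ℓ₀ ⊗ ℓ₁)) ℓ₁) refl

  -- With g = [c,x]: g^t = (g^x)^(xt) = (g⁻¹)^(xt), so [g,t] = g⁻¹ g^t = g⁻² [g⁻¹,xt].
  comm-comm-letter : ∀ (c : Word d) (x t : Fin d) →
    comm (comm c (x ∷ [])) (t ∷ [])
      ≋ ((inv (comm c (x ∷ [])) · inv (comm c (x ∷ []))) · comm (inv (comm c (x ∷ []))) (x ∷ t ∷ []))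
  comm-comm-letter c x t = prove (c ∷ []) (x ∷ t ∷ [])
    (commᴱ (commᴱ x₀ ℓ₀) ℓ₁)
    ((ı (commᴱ x₀ ℓ₀) ⊗ ı (commᴱ x₀ ℓ₀)) ⊗ commᴱ (ı (commᴱ x₀ ℓ₀)) (ℓ₀ ⊗ ℓ₁)) refl

  pair-from-∷t : ∀ (a b t : Fin d) → ((a ∷ t ∷ []) · inv (b ∷ t ∷ [])) ≋ (a ∷ b ∷ [])
  pair-from-∷t a b t = prove [] (a ∷ b ∷ t ∷ []) ((ℓ₀ ⊗ ℓ₂) ⊗ ı (ℓ₁ ⊗ ℓ₂)) (ℓ₀ ⊗ ℓ₁) refl

  comm-congˡ : ∀ {a a′ : Word d} k → a ≋ a′ → comm a k ≋ comm a′ k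
  comm-congˡ k a≋a′ = ·-cong (inv-cong a≋a′) (·-congˡ (inv k) (·-congʳ k a≋a′))

module _ {d : ℕ} where

  ConjugationClosed : Subset d → Set
  ConjugationClosed H = ∀ {g} w → H g → H (conj g w)

  record IsSubgroup (H : Subset d) : Set where
    field
      ≋-closed   : ∀ {g h} → g ≋ h → H g → H h
      []-closed  : H []
      ·-closed   : ∀ {g h} → H g → H h → H (g · h)
      inv-closed : ∀ {g} → H g → H (inv g)

  record IsNormal (H : Subset d) : Set where
    field
      isSubgroup  : IsSubgroup H
      conj-closed : ConjugationClosed H
    open IsSubgroup isSubgroup public

  open IsSubgroup
  open IsNormal using (isSubgroup; conj-closed)

  ⟨⟩-isSubgroup : ∀ {S : Subset d} → IsSubgroup ⟨ S ⟩
  ⟨⟩-isSubgroup = record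
    { ≋-closed = λ g≋h → resp (to≈ g≋h) ; []-closed = one ; ·-closed = mul ; inv-closed = inv∈ }

  ⟨⟩-least : ∀ {S H : Subset d} → IsSubgroup H → S ⊆ H → ⟨ S ⟩ ⊆ H
  ⟨⟩-least H S⊆H (gen s)       = S⊆H s
  ⟨⟩-least H S⊆H one           = []-closed H
  ⟨⟩-least H S⊆H (mul g h)     = ·-closed H (⟨⟩-least H S⊆H g) (⟨⟩-least H S⊆H h)
  ⟨⟩-least H S⊆H (inv∈ g)      = inv-closed H (⟨⟩-least H S⊆H g)
  ⟨⟩-least H S⊆H (resp g≈h g)  = ≋-closed H (from≈ g≈h) (⟨⟩-least H S⊆H g)

  ⟨⟩-normal : ∀ {S : Subset d} → (∀ {g} w → S g → ⟨ S ⟩ (conj g w)) → IsNormal ⟨ S ⟩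
  ⟨⟩-normal {S} conj-gen = record
    { isSubgroup  = ⟨⟩-isSubgroup
    ; conj-closed = λ w g∈ → ⟨⟩-least conjugates-stay (λ s w′ → conj-gen w′ s) g∈ w }
    where
    conjugates-stay : IsSubgroup (λ g → ∀ w → ⟨ S ⟩ (conj g w))
    conjugates-stay = record
      { ≋-closed   = λ g≋h g∈ w → ≋-closed ⟨⟩-isSubgroup
                       (·-congˡ (inv w) (·-congʳ w g≋h)) (g∈ w)
      ; []-closed  = λ w → ≋-closed ⟨⟩-isSubgroup (≋-sym (conj-identityˡ w)) one
      ; ·-closed   = λ {g} {h} g∈ h∈ w → ≋-closed ⟨⟩-isSubgroup (≋-sym (conj-· g h w))
                       (mul (g∈ w) (h∈ w))
      ; inv-closed = λ {g} g∈ w → ≋-closed ⟨⟩-isSubgroup (≋-sym (conj-inv g w)) (inv∈ (g∈ w)) }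

  Whole-normal : IsNormal (Whole d)
  Whole-normal = record
    { isSubgroup  = record
      { ≋-closed = λ _ _ → tt ; []-closed = tt ; ·-closed = λ _ _ → tt ; inv-closed = λ _ → tt }
    ; conj-closed = λ _ _ → tt }

  [,]-normal : ∀ {H K : Subset d} → ConjugationClosed H → ConjugationClosed K → IsNormal [ H , K ]
  [,]-normal H-conj K-conj = ⟨⟩-normal λ { w (h , k , h∈ , k∈ , refl) →
    ≋-closed ⟨⟩-isSubgroup (≋-sym (conj-comm h k w))
      (gen (conj h w , conj k w , H-conj w h∈ , K-conj w k∈ , refl)) }

  Sq-normal : ∀ {H : Subset d} → ConjugationClosed H → IsNormal (Sq H)
  Sq-normal H-conj = ⟨⟩-normal λ { w (h , h∈ , refl) →
    ≋-closed ⟨⟩-isSubgroup (≋-sym (conj-· h h w)) (gen (conj h w , H-conj w h∈ , refl)) }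

  ⊙-normal : ∀ {H K : Subset d} → IsNormal H → IsNormal K → IsNormal (H ⊙ K)
  ⊙-normal H K = record
    { isSubgroup = record
      { ≋-closed   = λ { {g} g≋g′ (h , k , h∈ , k∈ , g≈hk) →
                       h , k , h∈ , k∈ , to≈ (≋-trans (≋-sym g≋g′) (≈⇒≋ g (h · k) g≈hk)) }
      ; []-closed  = [] , [] , []-closed (isSubgroup H) , []-closed (isSubgroup K) , refl
      ; ·-closed   = λ { {g} {g′} (h₁ , k₁ , h₁∈ , k₁∈ , g≈) (h₂ , k₂ , h₂∈ , k₂∈ , g′≈) →
                       h₁ · conj h₂ (inv k₁) , k₁ · k₂ ,
                       ·-closed (isSubgroup H) h₁∈ (conj-closed H (inv k₁) h₂∈) ,
                       ·-closed (isSubgroup K) k₁∈ k₂∈ ,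
                       to≈ (≋-trans (·-cong (≈⇒≋ g (h₁ · k₁) g≈) (≈⇒≋ g′ (h₂ · k₂) g′≈))
                                    (·-interchange h₁ k₁ h₂ k₂)) }
      ; inv-closed = λ { {g} (h , k , h∈ , k∈ , g≈) →
                       conj (inv h) k , inv k ,
                       conj-closed H k (inv-closed (isSubgroup H) h∈) ,
                       inv-closed (isSubgroup K) k∈ ,
                       to≈ (≋-trans (inv-cong (≈⇒≋ g (h · k) g≈)) (inv-· h k)) } }
    ; conj-closed = λ { {g} w (h , k , h∈ , k∈ , g≈) →
        conj h w , conj k w , conj-closed H w h∈ , conj-closed K w k∈ ,
        to≈ (≋-trans (·-congˡ (inv w) (·-congʳ w (≈⇒≋ g (h · k) g≈))) (conj-· h k w)) } }

  ⊙-injectˡ : ∀ {H K : Subset d} → IsSubgroup K → H ⊆ H ⊙ K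
  ⊙-injectˡ K {g} h∈ = g , [] , h∈ , []-closed K , cong reduce (sym (++-identityʳ g))

  ⊙-injectʳ : ∀ {H K : Subset d} → IsSubgroup H → K ⊆ H ⊙ K
  ⊙-injectʳ H {g} k∈ = [] , g , []-closed H , k∈ , refl

  [,]-mono : ∀ {H H′ K K′ : Subset d} → H ⊆ H′ → K ⊆ K′ → [ H , K ] ⊆ [ H′ , K′ ]
  [,]-mono H⊆H′ K⊆K′ = ⟨⟩-least ⟨⟩-isSubgroup
    λ { (h , k , h∈ , k∈ , refl) → gen (h , k , H⊆H′ h∈ , K⊆K′ k∈ , refl) }

  Sq-mono : ∀ {H H′ : Subset d} → H ⊆ H′ → Sq H ⊆ Sq H′
  Sq-mono H⊆H′ = ⟨⟩-least ⟨⟩-isSubgroup λ { (h , h∈ , refl) → gen (h , H⊆H′ h∈ , refl) }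

  γ-normal : ∀ i → IsNormal (γ d i)
  γ-normal zero          = Whole-normal
  γ-normal (suc zero)    = Whole-normal
  γ-normal (suc (suc i)) = [,]-normal (conj-closed (γ-normal (suc i))) (λ _ _ → tt)

  -- [c,xw] = [c,w] [c,x]^w
  comm-from-letters : ∀ {U : Subset d} → IsNormal U → (c : Word d) →
                      (∀ x → U (comm c (x ∷ []))) → ∀ w → U (comm c w)
  comm-from-letters U c c-letter [] = ≋-closed (isSubgroup U) (≋-sym (comm-identityʳ c)) ([]-closed (isSubgroup U))
  comm-from-letters U c c-letter (x ∷ w) = ≋-closed (isSubgroup U) (≋-sym (comm-·ʳ c (x ∷ []) w))
    (·-closed (isSubgroup U) (comm-from-letters U c c-letter w) (conj-closed U w (c-letter x)))

  square∈γ₂ : ∀ h → γ d 2 (h · h)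
  square∈γ₂ [] = one
  square∈γ₂ (x ∷ h) = ≋-closed ⟨⟩-isSubgroup (≋-sym (square-∷ x h))
    (mul (gen (x ∷ [] , inv h , tt , tt , refl)) (square∈γ₂ h))

  odd : Word d → Bool
  odd []      = false
  odd (_ ∷ u) = not (odd u)

  odd-++ : ∀ u v → odd (u ++ v) ≡ odd u xor odd v
  odd-++ []      v = refl
  odd-++ (_ ∷ u) v = trans (cong not (odd-++ u v)) (not-distribˡ-xor (odd u) (odd v))

  odd-reverse : ∀ u → odd (reverse u) ≡ odd u
  odd-reverse []      = refl
  odd-reverse (x ∷ u) = begin
    odd (reverse (x ∷ u))      ≡⟨ cong odd (reverse-++ (x ∷ []) u) ⟩
    odd (reverse u ++ x ∷ [])  ≡⟨ odd-++ (reverse u) (x ∷ []) ⟩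
    odd (reverse u) xor true   ≡⟨ xor-comm (odd (reverse u)) true ⟩
    not (odd (reverse u))      ≡⟨ cong not (odd-reverse u) ⟩
    not (odd u)                ∎
    where open ≡-Reasoning

  odd-inv-· : ∀ u v → odd (inv u · v) ≡ odd u xor odd v
  odd-inv-· u v = trans (odd-++ (inv u) v) (cong (_xor odd v) (odd-reverse u))

  odd-comm : ∀ a b → odd (comm a b) ≡ false
  odd-comm a b = begin
    odd (comm a b)                            ≡⟨ odd-inv-· a _ ⟩
    odd a xor odd (inv b · (a · b))           ≡⟨ cong (odd a xor_) (odd-inv-· b (a · b)) ⟩
    odd a xor (odd b xor odd (a · b))         ≡⟨ cong (λ z → odd a xor (odd b xor z)) (odd-++ a b) ⟩
    odd a xor (odd b xor (odd a xor odd b))   ≡⟨ cancel (odd a) (odd b) ⟩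
    false                                     ∎
    where
    open ≡-Reasoning
    cancel : ∀ x y → x xor (y xor (x xor y)) ≡ false
    cancel false y = xor-same y
    cancel true  y = cong not (xor-inverseʳ y)

  odd-conj : ∀ g w → odd g ≡ false → odd (conj g w) ≡ false
  odd-conj g w g-even = begin
    odd (conj g w)              ≡⟨ odd-inv-· w (g · w) ⟩
    odd w xor odd (g · w)       ≡⟨ cong (odd w xor_) (odd-++ g w) ⟩
    odd w xor (odd g xor odd w) ≡⟨ cong (λ z → odd w xor (z xor odd w)) g-even ⟩
    odd w xor odd w             ≡⟨ xor-same (odd w) ⟩
    false                       ∎
    where open ≡-Reasoning

module _ {d′ : ℕ} where

  private
    d : ℕ
    d = suc d′

  open IsSubgroup
  open IsNormal using (isSubgroup; conj-closed)

  t : Fin d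
  t = fromℕ d′

  F-∷t : ∀ a → F d (a ∷ t ∷ [])
  F-∷t a with toℕ a ≟ℕ d′
  ... | no a≢d′ = gen (a , t , ≤∧≢⇒< (toℕ≤pred[n] a) a≢d′ , toℕ-fromℕ d′ , refl)
  ... | yes a≡d′ with toℕ-injective {i = a} {j = t} (trans a≡d′ (sym (toℕ-fromℕ d′)))
  ...   | refl = ≋-closed ⟨⟩-isSubgroup (≋-sym (letter-square t)) one

  F-pair : ∀ a b → F d (a ∷ b ∷ [])
  F-pair a b = ≋-closed ⟨⟩-isSubgroup (pair-from-∷t a b t) (mul (F-∷t a) (inv∈ (F-∷t b)))

  even⇒F : ∀ u → odd u ≡ false → F d u
  even⇒F []          _      = one
  even⇒F (a ∷ b ∷ u) u-even = mul (F-pair a b) (even⇒F u (trans (sym (not-involutive (odd u))) u-even))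

  F-normal : IsNormal (F d)
  F-normal = ⟨⟩-normal λ { w (i , j , _ , _ , refl) → even⇒F _ (odd-conj (i ∷ j ∷ []) w refl) }

  comm∈F : ∀ a b → F d (comm a b)
  comm∈F a b = even⇒F (comm a b) (odd-comm a b)

  Next : Subset d → Subset d
  Next H = [ H , F d ] ⊙ Sq H

  Next-mono : ∀ {H K : Subset d} → H ⊆ K → Next H ⊆ Next K
  Next-mono H⊆K (h , k , h∈ , k∈ , g≈hk) = h , k , [,]-mono H⊆K (λ g∈ → g∈) h∈ , Sq-mono H⊆K k∈ , g≈hk

  Next-normal : ∀ {H : Subset d} → ConjugationClosed H → IsNormal (Next H)
  Next-normal H-conj = ⊙-normal ([,]-normal H-conj (conj-closed F-normal)) (Sq-normal H-conj)

  γ₂⊆P₂ : γ d 2 ⊆ P d 2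
  γ₂⊆P₂ = ⟨⟩-least (isSubgroup P₂-normal) λ { (a , b , _ , _ , refl) → comm∈P₂ a b }
    where
    P₂-normal : IsNormal (P d 2)
    P₂-normal = Next-normal (conj-closed F-normal)
    -- [x,z] = (xz)², letters being involutions.
    letters : ∀ x z → P d 2 (comm (x ∷ []) (z ∷ []))
    letters x z = ⊙-injectʳ ⟨⟩-isSubgroup (gen (x ∷ z ∷ [] , F-pair x z , refl))
    comm∈P₂ : ∀ a b → P d 2 (comm a b)
    comm∈P₂ a = comm-from-letters P₂-normal a λ x →
      ≋-closed (isSubgroup P₂-normal) (≋-sym (comm-swap a (x ∷ [])))
        (inv-closed (isSubgroup P₂-normal) {comm (x ∷ []) a} (comm-from-letters P₂-normal (x ∷ []) (letters x) a))

  P₂⊆γ₂ : P d 2 ⊆ γ d 2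
  P₂⊆γ₂ {g} (h , k , h∈ , k∈ , g≈hk) = ≋-closed ⟨⟩-isSubgroup (≋-sym (≈⇒≋ g (h · k) g≈hk))
    (mul ([,]-mono (λ _ → tt) (λ _ → tt) h∈)
         (⟨⟩-least ⟨⟩-isSubgroup (λ { (a , _ , refl) → square∈γ₂ a }) k∈))

  module _ (C : Subset d) (C-conj : ConjugationClosed C) where

    private
      Q : Subset d
      Q = [ C , Whole d ]

      Q-normal : IsNormal Q
      Q-normal = [,]-normal C-conj (λ _ _ → tt)

      [Q,W]-normal : IsNormal [ Q , Whole d ]
      [Q,W]-normal = [,]-normal (conj-closed Q-normal) (λ _ _ → tt)

      Next-Q-normal : IsNormal (Next Q)
      Next-Q-normal = Next-normal (conj-closed Q-normal)

      module Q = IsNormal Q-normal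
      module [Q,W] = IsNormal [Q,W]-normal
      module NextQ = IsNormal Next-Q-normal

      T : Word d
      T = t ∷ []

    square∈[Q,W] : ∀ {g} → Q g → [ Q , Whole d ] (g · g)
    square∈[Q,W] g∈ = proj₂ (⟨⟩-least (isSubgroup S-normal)
      (λ { (c , w , c∈ , _ , refl) → comm∈S c c∈ w }) g∈)
      where
      S : Subset d
      S = Q ∩ λ g → [ Q , Whole d ] (g · g)
      S-normal : IsNormal S
      S-normal = record
        { isSubgroup = record
          { ≋-closed   = λ g≋h (q , s) → Q.≋-closed g≋h q , [Q,W].≋-closed (·-cong g≋h g≋h) s
          ; []-closed  = Q.[]-closed , [Q,W].[]-closed
          ; ·-closed   = λ { {a} {b} (qa , sa) (qb , sb) → Q.·-closed qa qb ,
              [Q,W].≋-closed (≋-sym (square-· a b))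
                ([Q,W].·-closed ([Q,W].·-closed sa (gen (a , inv b , qa , tt , refl))) sb) }
          ; inv-closed = λ { {a} (qa , sa) → Q.inv-closed qa ,
              [Q,W].≋-closed (≋-sym (square-inv a)) ([Q,W].inv-closed sa) } }
        ; conj-closed = λ { {g} w (q , s) → Q.conj-closed w q ,
            [Q,W].≋-closed (conj-· g g w) ([Q,W].conj-closed w s) } }
      comm∈S : ∀ c → C c → ∀ w → S (comm c w)
      comm∈S c c∈ = comm-from-letters S-normal c λ x →
        let q = gen (c , x ∷ [] , c∈ , tt , refl) in
        q , [Q,W].≋-closed (≋-sym (square-comm-letter c x))
              ([Q,W].inv-closed (gen (comm c (x ∷ []) , x ∷ [] , q , tt , refl)))

    comm-t∈Next : ∀ {g} → Q g → Next Q (comm g T)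
    comm-t∈Next g∈ = proj₂ (⟨⟩-least (isSubgroup V-normal)
      (λ { (c , w , c∈ , _ , refl) → comm∈V c c∈ w }) g∈)
      where
      [Q,F]⊆Next : [ Q , F d ] ⊆ Next Q
      [Q,F]⊆Next = ⊙-injectˡ ⟨⟩-isSubgroup
      V : Subset d
      V = Q ∩ λ g → Next Q (comm g T)
      V-normal : IsNormal V
      V-normal = record
        { isSubgroup = record
          { ≋-closed   = λ g≋h (q , n) → Q.≋-closed g≋h q , NextQ.≋-closed (comm-congˡ T g≋h) n
          ; []-closed  = Q.[]-closed , NextQ.≋-closed (≋-sym (comm-identityˡ T)) NextQ.[]-closed
          ; ·-closed   = λ { {a} {b} (qa , na) (qb , nb) → Q.·-closed qa qb ,
              NextQ.≋-closed (≋-sym (comm-·ˡ a b T))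
                (NextQ.·-closed {conj (comm a T) b} (NextQ.conj-closed {comm a T} b na) nb) }
          ; inv-closed = λ { {a} (qa , na) → Q.inv-closed qa ,
              NextQ.≋-closed (≋-sym (comm-invˡ a T))
                (NextQ.conj-closed (inv a) (NextQ.inv-closed {comm a T} na)) } }
        ; conj-closed = λ { {g} w (q , n) → Q.conj-closed w q ,
            NextQ.≋-closed (≋-sym (comm-conjˡ g w T))
              (NextQ.·-closed {conj (comm g T) w} (NextQ.conj-closed {comm g T} w n)
                ([Q,F]⊆Next (gen (conj (conj g T) w , comm w T ,
                  Q.conj-closed w (Q.conj-closed T q) , comm∈F w T , refl)))) } }
      comm∈V : ∀ c → C c → ∀ w → V (comm c w)
      comm∈V c c∈ = comm-from-letters V-normal c λ x →
        let g = comm c (x ∷ [])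
            g⁻¹∈ = Q.inv-closed (gen (c , x ∷ [] , c∈ , tt , refl))
        in gen (c , x ∷ [] , c∈ , tt , refl) ,
           NextQ.≋-closed (≋-sym (comm-comm-letter c x t))
             (NextQ.·-closed {inv g · inv g}
               (⊙-injectʳ ⟨⟩-isSubgroup (gen (inv g , g⁻¹∈ , refl)))
               ([Q,F]⊆Next (gen (inv g , x ∷ t ∷ [] , g⁻¹∈ , F-∷t x , refl))))

    [Q,W]⊆Next : [ Q , Whole d ] ⊆ Next Q
    [Q,W]⊆Next = ⟨⟩-least (isSubgroup Next-Q-normal) λ { (q , w , q∈ , _ , refl) →
      comm-from-letters Next-Q-normal q (λ x →
        NextQ.≋-closed (≋-sym (comm-letter-split q x t))
          (NextQ.·-closed {comm q T} (comm-t∈Next q∈)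
            (NextQ.conj-closed {comm q (x ∷ t ∷ [])} T
              (⊙-injectˡ ⟨⟩-isSubgroup (gen (q , x ∷ t ∷ [] , q∈ , F-∷t x , refl)))))) w }

    Next⊆[Q,W] : Next Q ⊆ [ Q , Whole d ]
    Next⊆[Q,W] {g} (h , k , h∈ , k∈ , g≈hk) = [Q,W].≋-closed (≋-sym (≈⇒≋ g (h · k) g≈hk))
      ([Q,W].·-closed ([,]-mono (λ q∈ → q∈) (λ _ → tt) h∈)
                      (⟨⟩-least [Q,W].isSubgroup (λ { (a , a∈ , refl) → square∈[Q,W] a∈ }) k∈))

  P≐γ : ∀ i → P d (2 + i) ≐ γ d (2 + i)
  P≐γ zero    = P₂⊆γ₂ , γ₂⊆P₂
  P≐γ (suc i) = (λ {g} g∈ → Next⊆[Q,W] C C-conj (Next-mono (proj₁ (P≐γ i)) {g} g∈))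
              , (λ {g} g∈ → Next-mono (proj₂ (P≐γ i)) {g} ([Q,W]⊆Next C C-conj g∈))
    where
    C : Subset d
    C = γ d (suc i)
    C-conj : ConjugationClosed C
    C-conj = conj-closed (γ-normal (suc i))

lemma5p2 : (d : ℕ) → 3 ≤ d → (i : ℕ) → 2 ≤ i →
    (g : Word d) → (P d i g → γ d i g) × (γ d i g → P d i g)
lemma5p2 zero     ()
lemma5p2 (suc d′) _ 0 ()
lemma5p2 (suc d′) _ 1 (s≤s ())
lemma5p2 (suc d′) _ (suc (suc i)) _ g = proj₁ (P≐γ i) {g} , proj₂ (P≐γ i) {g}
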